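{- Let $G$ be a connected graph and let $\mathrm{Forb\text{ - }con}(G)$ be the class of graphs $M$ such that no connected component of $M$ is isomorphic to $G$. For $M,N\in\mathrm{Forb\text{ - }con}(G)$ define $M\preceq N$ iff $M$ is an induced subgraph of $N$ and for every complete subgraph $C$ of $N$ that is embeddable in $G$, if $C\cap M\neq\emptyset$ then $C\cap N\subseteq M$. Then the following strong coherence holds: if $M_0,M_1,M_2\in\mathrm{Forb\text{ - }con}(G)$, $M_0\subseteq M_1\subseteq M_2$ (as induced subgraphs) and $M_0\preceq M_2$, then $M_0\preceq M_1$.
   Context: A graph is a structure $(V,E)$ with $E$ an irreflexive symmetric binary relation; "embeddable in $G$" means isomorphic to an induced subgraph of $G$. -}

module Defs where

open import Data.Product using (Σ; ∃; _×_; _,_)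
open import Data.Unit using (⊤)
open import Relation.Nullary using (¬_)
open import Relation.Binary.PropositionalEquality using (_≡_; _≢_)
open import Relation.Binary.Construct.Closure.ReflexiveTransitive using (Star)

record Graph : Set₁ where
  field
    V     : Set
    E     : V → V → Set
    irref : ∀ x → ¬ E x x
    symm  : ∀ {x y} → E x y → E y x
open Graph public

VSet : Graph → Set₁
VSet N = V N → Set

_⊆_ : {N : Graph} → VSet N → VSet N → Set
_⊆_ {N} P Q = ∀ (x : V N) → P x → Q x

Whole : (N : Graph) → VSet N
Whole N _ = ⊤

IsoOnto : (G N : Graph) → VSet N → Set
IsoOnto G N P =
  Σ (V G → V N) λ f →
      (∀ x y → f x ≡ f y → x ≡ y)
    × (∀ x y → E G x y → E N (f x) (f y))
    × (∀ x y → E N (f x) (f y) → E G x y)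
    × (∀ x → P (f x))
    × (∀ w → P w → ∃ λ x → f x ≡ w)

EmbeddableIn : (N : Graph) → VSet N → Graph → Set
EmbeddableIn N P G =
  Σ ((w : V N) → P w → V G) λ g →
      (∀ w w' (p : P w) (p' : P w') → g w p ≡ g w' p' → w ≡ w')
    × (∀ w w' (p : P w) (p' : P w') → E N w w' → E G (g w p) (g w' p'))
    × (∀ w w' (p : P w) (p' : P w') → E G (g w p) (g w' p') → E N w w')

Connected : Graph → Set
Connected G = V G × (∀ x y → Star (E G) x y)

EdgeIn : (N : Graph) → VSet N → V N → V N → Set
EdgeIn N P x y = P x × P y × E N x y

Component : (N : Graph) → VSet N → V N → VSet N
Component N P v w = P w × Star (EdgeIn N P) v w

ForbCon : Graph → (N : Graph) → VSet N → Set
ForbCon G N P = ∀ v → P v → ¬ IsoOnto G N (Component N P v)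

Complete : (N : Graph) → VSet N → Set
Complete N C = ∀ x y → C x → C y → x ≢ y → E N x y

Prec : (G N : Graph) → VSet N → VSet N → Set₁
Prec G N P Q =
    (_⊆_ {N} P Q)
  × (∀ (C : VSet N) → _⊆_ {N} C Q → Complete N C → EmbeddableIn N C G →
       (∃ λ x → C x × P x) → _⊆_ {N} C P)

module Submission where

open import Defs
open import Data.Product using (_,_)
open import Data.Unit using (tt)

-- Shrinking the ambient set only removes cliques that must be tested,
-- so the condition survives as long as P stays inside it.
Prec-antitone : (G N : Graph) (P Q R : VSet N) →
  _⊆_ {N} P Q → _⊆_ {N} Q R → Prec G N P R → Prec G N P Q
Prec-antitone G N P Q R P⊆Q Q⊆R (_ , closed) =
  P⊆Q , λ C C⊆Q → closed C (λ x Cx → Q⊆R x (C⊆Q x Cx))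

mainTheorem8 : (G : Graph) → Connected G →
    (M₂ : Graph) (M₀ M₁ : VSet M₂) →
    ForbCon G M₂ M₀ → ForbCon G M₂ M₁ → ForbCon G M₂ (Whole M₂) →
    _⊆_ {M₂} M₀ M₁ →
    Prec G M₂ M₀ (Whole M₂) →
    Prec G M₂ M₀ M₁
mainTheorem8 G _ M₂ M₀ M₁ _ _ _ M₀⊆M₁ M₀⪯M₂ =
  Prec-antitone G M₂ M₀ M₁ (Whole M₂) M₀⊆M₁ (λ _ _ → tt) M₀⪯M₂
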